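{- Let $G$ be a graph with vertex set $\{v_1,\dots,v_n\}$ and $t$ a positive integer, and let $G'$, $\alpha$, $\beta$ be constructed from $(G,t)$ as described in the context; let $k=n+t+1$ and $\ell=2t+2t^2$. If $G$ has an independent set of size at least $t-1$, then $\mathcal{C}_k(G')$ contains a path from $\alpha$ to $\beta$ of length at most $\ell$.
   Context: A $k$-coloring of a graph is a map from its vertices to $\{1,\dots,k\}$ giving adjacent vertices different colors; $\mathcal{C}_k(H)$ is the graph whose vertices are the $k$-colorings of $H$, two being adjacent iff they differ on exactly one vertex. Construction: $B_t$ is the graph on $\{b^i_j\mid i,j\in\{1,\dots,t\}\}$ with $b^i_j b^{i'}_{j'}$ an edge iff $i\ne i'$ and $j\ne j'$. The graph $G'$ has vertex set $V_G\cup V_B\cup V_C$ (pairwise disjoint), where $V_G=\{g_1,\dots,g_n\}$ induces a copy of $G$ ($g_ig_j$ an edge iff $v_iv_j\in E(G)$), $V_B=\{b^i_j\}$ induces a copy of $B_t$, and $V_C=C_1\cup\dots\cup C_{n+t+1}$ where the $C_i$ are pairwise disjoint sets each of size $2t+2t^2$, and $V_C$ is an independent set. Further edges: all edges between $V_G$ and $V_B$; for each $g_i$, all edges between $g_i$ and $V_C\setminus(C_i\cup C_{n+t+1})$; for each $b\in V_B$, all edges between $b$ and $C_{n+t+1}$. There are no other edges. The coloring $\alpha$ is: $\alpha(g_i)=i$; $\alpha(c)=i$ for every $c\in C_i$; $\alpha(b^i_j)=n+i$. The coloring $\beta$ equals $\alpha$ on $V_G\cup V_C$ and $\beta(b^i_j)=n+j$.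 -}

module Defs where

open import Data.Nat using (ℕ; zero; suc; _+_; _*_; _≤_; _∸_)
open import Data.Fin using (Fin; zero; suc; inject₁; fromℕ; _↑ˡ_; _↑ʳ_)
open import Data.Fin.Subset using (Subset; _∈_; ∣_∣)
open import Data.Bool using (Bool; true; false)
open import Data.Product using (Σ; _×_; _,_; ∃; ∃-syntax)
open import Data.Sum using (_⊎_; inj₁; inj₂)
open import Data.Unit using (⊤)
open import Data.Empty using (⊥)
open import Relation.Binary.PropositionalEquality using (_≡_; _≢_)

-- Finite simple graphs on the vertex set {v_1,…,v_n}, represented as Fin n
-- (v_{i+1} ↔ the element i of Fin n), with Bool-valued adjacency.

record Graph (n : ℕ) : Set where
  field
    adj   : Fin n → Fin n → Bool
    sym   : ∀ i j → adj i j ≡ adj j i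
    irrefl : ∀ i → adj i i ≡ false
open Graph public

Edge : ∀ {n} → Graph n → Fin n → Fin n → Set
Edge G i j = adj G i j ≡ true

IsIndependent : ∀ {n} → Graph n → Subset n → Set
IsIndependent G S = ∀ i j → i ∈ S → j ∈ S → adj G i j ≡ false

-- Generic colorings and the reconfiguration graph C_k(H).
-- H is given by a vertex type V and an adjacency relation A.
-- Colors {1,…,k} are represented by Fin k (color c+1 ↔ c).

IsColoring : {V : Set} (A : V → V → Set) (k : ℕ) → (V → Fin k) → Set
IsColoring A k f = ∀ u v → A u v → f u ≢ f v

-- two colorings are adjacent in C_k(H) iff they differ on exactly one vertex
DifferOnExactlyOne : {V : Set} {k : ℕ} → (V → Fin k) → (V → Fin k) → Set
DifferOnExactlyOne {V} f g = Σ V λ v → f v ≢ g v × (∀ w → w ≢ v → f w ≡ g w)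

PathOfLength : {V : Set} (A : V → V → Set) (k : ℕ) →
               (V → Fin k) → (V → Fin k) → ℕ → Set
PathOfLength {V} A k a b m =
  Σ (Fin (suc m) → V → Fin k) λ c →
      (∀ i → IsColoring A k (c i))
    × (∀ v → c zero v ≡ a v)
    × (∀ v → c (fromℕ m) v ≡ b v)
    × (∀ (i : Fin m) → DifferOnExactlyOne (c (inject₁ i)) (c (suc i)))
    × (∀ i j → i ≢ j → Σ V λ v → c i v ≢ c j v)

-- ℓ = 2t + 2t², the size of each C_i
ell : ℕ → ℕ
ell t = 2 * t + 2 * (t * t)

-- Vertices: g_i (i ∈ Fin n), b^i_j ((i , j) ∈ Fin t × Fin t),
-- and c ∈ C_m represented as (m , r) with m ∈ Fin (n+t+1) (C_{m+1}), r ∈ Fin ℓ.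
-- Note n + t + 1 is written suc (n + t).
data V' (n t : ℕ) : Set where
  gv : Fin n → V' n t
  bv : Fin t → Fin t → V' n t
  cv : Fin (suc (n + t)) → Fin (ell t) → V' n t

-- index of C_i for g_i (i.e. C_{i} with i ∈ {1..n}) inside {1..n+t+1}
gIdx : ∀ {n} t → Fin n → Fin (suc (n + t))
gIdx t i = inject₁ (i ↑ˡ t)

lastIdx : ∀ n t → Fin (suc (n + t))
lastIdx n t = fromℕ (n + t)

-- index n+i (for i ∈ {1..t})
bIdx : ∀ n {t} → Fin t → Fin (suc (n + t))
bIdx n i = inject₁ (n ↑ʳ i)

Adj' : ∀ {n t} → Graph n → V' n t → V' n t → Set
Adj' G (gv i) (gv j) = Edge G i j
Adj' G (gv i) (bv _ _) = ⊤
Adj' {t = t} G (gv i) (cv m _) = m ≢ gIdx t i × m ≢ lastIdx _ t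
Adj' G (bv _ _) (gv _) = ⊤
Adj' G (bv i j) (bv i' j') = i ≢ i' × j ≢ j'
Adj' {n} {t} G (bv _ _) (cv m _) = m ≡ lastIdx n t
Adj' {t = t} G (cv m _) (gv i) = m ≢ gIdx t i × m ≢ lastIdx _ t
Adj' {n} {t} G (cv m _) (bv _ _) = m ≡ lastIdx n t
Adj' G (cv _ _) (cv _ _) = ⊥

α : ∀ {n t} → V' n t → Fin (suc (n + t))
α {t = t} (gv i) = gIdx t i
α {n} (bv i j) = bIdx n i
α (cv m _) = m

β : ∀ {n t} → V' n t → Fin (suc (n + t))
β {t = t} (gv i) = gIdx t i
β {n} (bv i j) = bIdx n j
β (cv m _) = m

module Submission where

-- Let e pick t − 1 vertices of the independent set. The path runs through six colorings
-- γ 0 = α, …, γ 5 = β of G′ (rows and columns of B_t are numbered from 0):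
--   0 → 1  each g_{e r} takes the color n+t+1, which is free on V_G ∪ V_B and is not
--          forbidden to g_{e r} by its neighbours in V_C;
--   1 → 2  each off-diagonal b^{suc r}_j takes the color freed by g_{e r};
--   2 → 3  row 0 takes its β-colors;
--   3 → 4  the other rows take their β-colors;
--   4 → 5  each g_{e r} returns to its own color.
-- Every coloring that agrees at each vertex with γ a or γ (suc a) is proper, so between
-- consecutive stages the vertices can be recolored one at a time. This gives a walk of length
-- (t−1) + (t−1)t + t + (t−1)t + (t−1) ≤ 2t + 2t², and erasing its loops leaves a path.

open import Defs hiding (sym)
open import Data.Nat using (ℕ; zero; suc; _+_; _*_; _≤_; _<_; _∸_; _>_; z≤n; s≤s; s≤s⁻¹; _≤?_; _<?_)
open import Data.Nat.Properties using (≤-refl; ≤-trans; ≤-reflexive; m≤n⇒m≤1+n; n≤1+n; <⇒≱; ≮⇒≥; m+n≤o⇒m≤o)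
open import Data.Nat.Tactic.RingSolver using (solve-∀)
open import Data.Fin using (Fin; zero; suc; inject₁; inject≤; _↑ˡ_; _↑ʳ_; splitAt; combine; remQuot)
open import Data.Fin.Properties using (suc-injective; inject₁-injective; inject≤-injective; ↑ˡ-injective; ↑ʳ-injective; splitAt-↑ˡ; splitAt-↑ʳ; fromℕ≢inject₁; remQuot-combine)
  renaming (_≟_ to _≟ᶠ_)
open import Data.Fin.Subset using (Subset; ∣_∣) renaming (_∈_ to _∈ˢ_)
open import Data.Bool using (true; false; if_then_else_)
open import Data.Vec.Base using (here; there) renaming ([] to []ᵥ; _∷_ to _∷ᵥ_)
open import Data.List using (List; []; _∷_; length; tabulate; map; _++_; allFin; cartesianProductWith)
open import Data.List.Properties using (length-tabulate)
open import Data.List.Membership.Propositional using (_∈_)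
open import Data.List.Membership.Propositional.Properties
  using (∈-tabulate⁺; ∈-tabulate⁻; ∈-allFin; ∈-map⁺; ∈-++⁺ˡ; ∈-++⁺ʳ; ∈-cartesianProductWith⁺)
open import Data.List.Relation.Unary.Any using (here; there; satisfied)
open import Data.List.Relation.Unary.All using (all?) renaming (lookup to All-lookup)
open import Data.List.Relation.Unary.All.Properties using (¬All⇒Any¬)
open import Data.Product using (Σ; _×_; _,_; proj₁; uncurry; swap)
open import Data.Sum using (_⊎_; inj₁; inj₂)
open import Data.Empty using (⊥)
open import Function using (_∘_)
open import Function.Definitions using (Injective)
open import Relation.Nullary using (¬_; Dec; yes; no; does; contradiction)
open import Relation.Nullary.Decidable using (map′; _×-dec_)
open import Relation.Binary using (DecidableEquality)
open import Relation.Binary.PropositionalEquality using (_≡_; _≢_; _≗_; refl; sym; trans; cong; cong₂; subst)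

module Reconfiguration {V : Set} (A : V → V → Set) (k : ℕ) where

  Coloring : Set
  Coloring = V → Fin k

  Distinct : Coloring → Coloring → Set
  Distinct f g = Σ V λ v → f v ≢ g v

  DifferOnAtMostOne : Coloring → Coloring → Set
  DifferOnAtMostOne f g = Σ V λ v → ∀ w → w ≢ v → f w ≡ g w

  private
    variable
      a a′ b b′ c f f′ g g′ X Y Z : Coloring
      m m′ : ℕ

  distinct-sym : Distinct f g → Distinct g f
  distinct-sym (v , fv≢gv) = v , fv≢gv ∘ sym

  isColoring-resp : f ≗ g → IsColoring A k g → IsColoring A k f
  isColoring-resp f≗g proper u v uv fu≡fv = proper u v uv (trans (sym (f≗g u)) (trans fu≡fv (f≗g v)))

  differOnAtMostOne-resp : f′ ≗ f → g ≗ g′ → DifferOnAtMostOne f g → DifferOnAtMostOne f′ g′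
  differOnAtMostOne-resp f′≗f g≗g′ (v , agree) = v , λ w w≢v → trans (f′≗f w) (trans (agree w w≢v) (g≗g′ w))

  -- u must be v; as the goal is a negation this needs no decidable equality on V.
  differOnExactlyOne : DifferOnAtMostOne f g → Distinct f g → DifferOnExactlyOne f g
  differOnExactlyOne {f} {g} (v , agree) (u , fu≢gu) = v , fv≢gv , agree
    where
      fv≢gv : f v ≢ g v
      fv≢gv fv≡gv = fu≢gu (agree u λ { refl → fu≢gu fv≡gv })

  data Walk : Coloring → Coloring → ℕ → Set where
    done : IsColoring A k a → a ≗ b → Walk a b 0
    move : IsColoring A k a → DifferOnAtMostOne a c → Walk c b m → Walk a b (suc m)

  walk-resp : a′ ≗ a → b ≗ b′ → Walk a b m → Walk a′ b′ m
  walk-resp a′≗a b≗b′ (done pa a≗b) =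
    done (isColoring-resp a′≗a pa) (λ v → trans (a′≗a v) (trans (a≗b v) (b≗b′ v)))
  walk-resp a′≗a b≗b′ (move pa a~c w) =
    move (isColoring-resp a′≗a pa) (differOnAtMostOne-resp a′≗a (λ _ → refl) a~c) (walk-resp (λ _ → refl) b≗b′ w)

  infixr 5 _++ʷ_

  _++ʷ_ : Walk a b m → Walk b c m′ → Walk a c (m + m′)
  done _ a≗b ++ʷ w′ = walk-resp a≗b (λ _ → refl) w′
  move pa a~c w ++ʷ w′ = move pa a~c (w ++ʷ w′)

  Mix : Coloring → Coloring → Coloring → Set
  Mix X Y Z = ∀ w → Z w ≡ X w ⊎ Z w ≡ Y w

  Compatible : Coloring → Coloring → Set
  Compatible X Y = ∀ u v → A u v → X u ≢ X v × X u ≢ Y v × Y u ≢ X v × Y u ≢ Y v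

  mix-isColoring : Compatible X Y → Mix X Y Z → IsColoring A k Z
  mix-isColoring {X} {Y} {Z} compatible mix u v uv with compatible u v uv | mix u | mix v
  ... | XX , _ , _ , _ | inj₁ p | inj₁ q = λ eq → XX (trans (sym p) (trans eq q))
  ... | _ , XY , _ , _ | inj₁ p | inj₂ q = λ eq → XY (trans (sym p) (trans eq q))
  ... | _ , _ , YX , _ | inj₂ p | inj₁ q = λ eq → YX (trans (sym p) (trans eq q))
  ... | _ , _ , _ , YY | inj₂ p | inj₂ q = λ eq → YY (trans (sym p) (trans eq q))

  module Recoloring (_≟_ : DecidableEquality V) where

    recolor : Coloring → Coloring → V → Coloring
    recolor Z Y v w = if does (w ≟ v) then Y w else Z w

    -- Every vertex of E is recolored in turn, even when its color does not change;
    -- this is why walks may stay put.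
    recolorWalk : Compatible X Y → (E : List V) → Mix X Y Z → (∀ w → Z w ≢ Y w → w ∈ E) →
                  Walk Z Y (length E)
    recolorWalk {X} {Y} {Z} compatible [] mix covered = done (mix-isColoring compatible mix) agree
      where
        agree : Z ≗ Y
        agree w with Z w ≟ᶠ Y w
        ... | yes Zw≡Yw = Zw≡Yw
        ... | no Zw≢Yw = contradiction (covered w Zw≢Yw) λ ()
    recolorWalk {X} {Y} {Z} compatible (v ∷ E) mix covered =
      move (mix-isColoring compatible mix) (v , agree) (recolorWalk compatible E mix′ covered′)
      where
        agree : ∀ w → w ≢ v → Z w ≡ recolor Z Y v w
        agree w w≢v with w ≟ v
        ... | yes w≡v = contradiction w≡v w≢v
        ... | no _ = refl
        mix′ : Mix X Y (recolor Z Y v)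
        mix′ w with w ≟ v
        ... | yes _ = inj₂ refl
        ... | no _ = mix w
        covered′ : ∀ w → recolor Z Y v w ≢ Y w → w ∈ E
        covered′ w differs with w ≟ v
        ... | yes _ = contradiction refl differs
        ... | no w≢v with covered w differs
        ...   | here w≡v = contradiction w≡v w≢v
        ...   | there w∈E = w∈E

  module LoopErasure (vertices : List V) (∈-vertices : ∀ v → v ∈ vertices) where

    ≗-or-distinct : (f g : Coloring) → f ≗ g ⊎ Distinct f g
    ≗-or-distinct f g with all? (λ v → f v ≟ᶠ g v) vertices
    ... | yes agree = inj₁ λ v → All-lookup agree (∈-vertices v)
    ... | no ¬agree = inj₂ (satisfied (¬All⇒Any¬ (λ v → f v ≟ᶠ g v) vertices ¬agree))

    Path : Coloring → Coloring → ℕ → Set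
    Path = PathOfLength A k

    colorings : Path a b m → Fin (suc m) → Coloring
    colorings = proj₁

    trivialPath : IsColoring A k a → a ≗ b → Path a b 0
    trivialPath {a} pa a≗b =
      (λ _ → a) , (λ _ → pa) , (λ _ → refl) , a≗b , (λ ()) , λ { zero zero 0≢0 → contradiction refl 0≢0 }

    tail : (P : Path a b (suc m)) → Path (colorings P (suc zero)) b m
    tail (col , proper , _ , end , steps , distinct) =
      col ∘ suc , proper ∘ suc , (λ _ → refl) , end , steps ∘ suc ,
      λ i j i≢j → distinct (suc i) (suc j) (i≢j ∘ suc-injective)

    prepend : (P : Path c b m) → IsColoring A k a → DifferOnAtMostOne a c →
              (∀ i → Distinct a (colorings P i)) → Path a b (suc m)
    prepend {a = a} (col , proper , start , end , steps , distinct) pa a~c fresh =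
      col′ , proper′ , (λ _ → refl) , end , steps′ , distinct′
      where
        col′ : Fin _ → Coloring
        col′ zero = a
        col′ (suc i) = col i
        proper′ : ∀ i → IsColoring A k (col′ i)
        proper′ zero = pa
        proper′ (suc i) = proper i
        steps′ : ∀ i → DifferOnExactlyOne (col′ (inject₁ i)) (col′ (suc i))
        steps′ zero = differOnExactlyOne (differOnAtMostOne-resp (λ _ → refl) (sym ∘ start) a~c) (fresh zero)
        steps′ (suc i) = steps i
        distinct′ : ∀ i j → i ≢ j → Distinct (col′ i) (col′ j)
        distinct′ zero zero 0≢0 = contradiction refl 0≢0
        distinct′ zero (suc j) _ = fresh j
        distinct′ (suc i) zero _ = distinct-sym (fresh i)
        distinct′ (suc i) (suc j) i≢j = distinct i j (i≢j ∘ cong suc)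

    shortcut : (a : Coloring) (P : Path c b m) →
               (Σ ℕ λ m′ → m′ ≤ m × Path a b m′) ⊎ (∀ i → Distinct a (colorings P i))
    shortcut a P with ≗-or-distinct a (colorings P zero)
    shortcut a (col , proper , _ , rest) | inj₁ a≗P₀ = inj₁ (_ , ≤-refl , col , proper , sym ∘ a≗P₀ , rest)
    shortcut {m = zero} a P | inj₂ a≉P₀ = inj₂ λ { zero → a≉P₀ }
    shortcut {m = suc m} a P | inj₂ a≉P₀ with shortcut a (tail P)
    ... | inj₁ (m′ , m′≤m , Q) = inj₁ (m′ , m≤n⇒m≤1+n m′≤m , Q)
    ... | inj₂ fresh = inj₂ λ { zero → a≉P₀ ; (suc i) → fresh i }

    loopErase : Walk a b m → Σ ℕ λ m′ → m′ ≤ m × Path a b m′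
    loopErase (done pa a≗b) = 0 , z≤n , trivialPath pa a≗b
    loopErase {a} (move pa a~c w) with loopErase w
    ... | m′ , m′≤m , P with shortcut a P
    ...   | inj₁ (m″ , m″≤m′ , Q) = m″ , m≤n⇒m≤1+n (≤-trans m″≤m′ m′≤m) , Q
    ...   | inj₂ fresh = suc m′ , s≤s m′≤m , prepend P pa a~c fresh

↑ˡ≢↑ʳ : ∀ {m n} (i : Fin m) (j : Fin n) → i ↑ˡ n ≢ m ↑ʳ j
↑ˡ≢↑ʳ {m} {n} i j eq with trans (sym (splitAt-↑ˡ m i n)) (trans (cong (splitAt m) eq) (splitAt-↑ʳ m n j))
... | ()

enumerate : ∀ {n} (S : Subset n) → Σ (Fin ∣ S ∣ → Fin n) λ f → Injective _≡_ _≡_ f × (∀ i → f i ∈ˢ S)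
enumerate []ᵥ = (λ ()) , (λ { {()} }) , λ ()
enumerate (false ∷ᵥ S) with enumerate S
... | f , f-injective , f∈S = suc ∘ f , f-injective ∘ suc-injective , there ∘ f∈S
enumerate (true ∷ᵥ S) with enumerate S
... | f , f-injective , f∈S = f′ , f′-injective , f′∈S
  where
    f′ : Fin (suc ∣ S ∣) → Fin _
    f′ zero = zero
    f′ (suc i) = suc (f i)
    f′-injective : Injective _≡_ _≡_ f′
    f′-injective {zero} {zero} _ = refl
    f′-injective {suc i} {suc j} eq = cong suc (f-injective (suc-injective eq))
    f′∈S : ∀ i → f′ i ∈ˢ (true ∷ᵥ S)
    f′∈S zero = here
    f′∈S (suc i) = there (f∈S i)

_≟ᵛ_ : ∀ {n t} → DecidableEquality (V' n t)
gv x ≟ᵛ gv y = map′ (cong gv) (λ { refl → refl }) (x ≟ᶠ y)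
bv i j ≟ᵛ bv i′ j′ = map′ (λ { (refl , refl) → refl }) (λ { refl → refl , refl }) ((i ≟ᶠ i′) ×-dec (j ≟ᶠ j′))
cv m r ≟ᵛ cv m′ r′ = map′ (λ { (refl , refl) → refl }) (λ { refl → refl , refl }) ((m ≟ᶠ m′) ×-dec (r ≟ᶠ r′))
gv _ ≟ᵛ bv _ _ = no λ ()
gv _ ≟ᵛ cv _ _ = no λ ()
bv _ _ ≟ᵛ gv _ = no λ ()
bv _ _ ≟ᵛ cv _ _ = no λ ()
cv _ _ ≟ᵛ gv _ = no λ ()
cv _ _ ≟ᵛ bv _ _ = no λ ()

allVertices : ∀ n t → List (V' n t)
allVertices n t =
  map gv (allFin n) ++ cartesianProductWith bv (allFin t) (allFin t) ++ cartesianProductWith cv (allFin _) (allFin _)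

∈-allVertices : ∀ {n t} (v : V' n t) → v ∈ allVertices n t
∈-allVertices (gv x) = ∈-++⁺ˡ (∈-map⁺ gv (∈-allFin x))
∈-allVertices {n} (bv i j) = ∈-++⁺ʳ (map gv (allFin n)) (∈-++⁺ˡ (∈-cartesianProductWith⁺ bv (∈-allFin i) (∈-allFin j)))
∈-allVertices {n} {t} (cv m r) = ∈-++⁺ʳ (map gv (allFin n)) (∈-++⁺ʳ (cartesianProductWith bv (allFin t) (allFin t))
  (∈-cartesianProductWith⁺ cv (∈-allFin m) (∈-allFin r)))

module Construction (n p : ℕ) (G : Graph n) (e : Fin p → Fin n) (e-injective : Injective _≡_ _≡_ e)
                    (image-independent : ∀ r r′ → adj G (e r) (e r′) ≡ false) where

  open import Data.List.Membership.DecPropositional (_≟ᶠ_ {n}) using () renaming (_∈?_ to _∈ˡ?_)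

  t k : ℕ
  t = suc p
  k = suc (n + t)

  Vertex : Set
  Vertex = V' n t

  open Reconfiguration (Adj' {n} {t} G) k
  open Recoloring _≟ᵛ_
  open LoopErasure (allVertices n t) ∈-allVertices

  data Color : Set where
    colG : Fin n → Color
    colB : Fin t → Color
    colLast : Color

  colG-injective : ∀ {x y} → colG x ≡ colG y → x ≡ y
  colG-injective refl = refl

  encode : Color → Fin k
  encode (colG x) = gIdx t x
  encode (colB i) = bIdx n i
  encode colLast = lastIdx n t

  encode-injective : Injective _≡_ _≡_ encode
  encode-injective {colG x} {colG y} eq = cong colG (↑ˡ-injective t x y (inject₁-injective eq))
  encode-injective {colG x} {colB i} eq = contradiction (inject₁-injective eq) (↑ˡ≢↑ʳ x i)
  encode-injective {colG x} {colLast} eq = contradiction (sym eq) fromℕ≢inject₁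
  encode-injective {colB i} {colG x} eq = contradiction (sym (inject₁-injective eq)) (↑ˡ≢↑ʳ x i)
  encode-injective {colB i} {colB j} eq = cong colB (↑ʳ-injective n i j (inject₁-injective eq))
  encode-injective {colB i} {colLast} eq = contradiction (sym eq) fromℕ≢inject₁
  encode-injective {colLast} {colG x} eq = contradiction eq fromℕ≢inject₁
  encode-injective {colLast} {colB i} eq = contradiction eq fromℕ≢inject₁
  encode-injective {colLast} {colLast} eq = refl

  freed : List (Fin n)
  freed = tabulate e

  freed-independent : ∀ {x y} → x ∈ freed → y ∈ freed → adj G x y ≡ false
  freed-independent x∈ y∈ with ∈-tabulate⁻ x∈ | ∈-tabulate⁻ y∈
  ... | r , refl | r′ , refl = image-independent r r′

  Near : ℕ → ℕ → Set
  Near a b = a ≤ suc b × b ≤ suc a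

  near-sym : ∀ {a b} → Near a b → Near b a
  near-sym = swap

  Parked : ℕ → Fin n → Set
  Parked a x = 1 ≤ a × a ≤ 4 × x ∈ freed

  parked? : ∀ a x → Dec (Parked a x)
  parked? a x = 1 ≤? a ×-dec a ≤? 4 ×-dec x ∈ˡ? freed

  gColor : ℕ → Fin n → Color
  gColor a x = if does (parked? a x) then colLast else colG x

  data GView (a : ℕ) (x : Fin n) : Color → Set where
    home   : ¬ Parked a x → GView a x (colG x)
    parked : Parked a x → GView a x colLast

  gView : ∀ a x → GView a x (gColor a x)
  gView a x = view (parked? a x)
    where
      view : (d : Dec (Parked a x)) → GView a x (if does d then colLast else colG x)
      view (yes P) = parked P
      view (no ¬P) = home ¬P

  -- Off the diagonal, b^i_j has its α-color before stage leave i and its β-color from stage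
  -- arrive i on; in between, row suc r holds the color of g_{e r}, which meanwhile sits on n+t+1.
  leave arrive : Fin t → ℕ
  leave zero = 3
  leave (suc _) = 2
  arrive zero = 3
  arrive (suc _) = 4

  bColor : ℕ → Fin t → Fin t → Color
  bColor a zero j = if does (a <? 3) then colB zero else colB j
  bColor a (suc r) j =
    if does (a <? 2) then colB (suc r)
    else if does (a <? 4) then (if does (j ≟ᶠ suc r) then colB j else colG (e r))
    else colB j

  data BView (a : ℕ) (i j : Fin t) : Color → Set where
    row     : a < leave i ⊎ i ≡ j → BView a i j (colB i)
    column  : arrive i ≤ a ⊎ i ≡ j → BView a i j (colB j)
    parking : ∀ r → i ≡ suc r → 2 ≤ a → a < 4 → BView a i j (colG (e r))

  bView : ∀ a i j → BView a i j (bColor a i j)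
  bView a zero j = view (a <? 3)
    where
      view : (a<3? : Dec (a < 3)) → BView a zero j (if does a<3? then colB zero else colB j)
      view (yes a<3) = row (inj₁ a<3)
      view (no a≮3) = column (inj₁ (≮⇒≥ a≮3))
  bView a (suc r) j = view (a <? 2) (a <? 4) (j ≟ᶠ suc r)
    where
      view : (a<2? : Dec (a < 2)) (a<4? : Dec (a < 4)) (j≟i : Dec (j ≡ suc r)) →
             BView a (suc r) j (if does a<2? then colB (suc r)
                                else if does a<4? then (if does j≟i then colB j else colG (e r))
                                else colB j)
      view (yes a<2) _ _ = row (inj₁ a<2)
      view (no a≮2) (no a≮4) _ = column (inj₁ (≮⇒≥ a≮4))
      view (no a≮2) (yes a<4) (yes refl) = column (inj₂ refl)
      view (no a≮2) (yes a<4) (no _) = parking r refl (≮⇒≥ a≮2) a<4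

  leave<arrive : ∀ {i i′} → i ≢ i′ → leave i < arrive i′
  leave<arrive {zero} {zero} 0≢0 = contradiction refl 0≢0
  leave<arrive {zero} {suc _} _ = ≤-refl
  leave<arrive {suc _} {zero} _ = ≤-refl
  leave<arrive {suc _} {suc _} _ = n≤1+n 3

  rowColumnClash : ∀ {a b i j i′ j′} → Near a b → a < leave i ⊎ i ≡ j → arrive i′ ≤ b ⊎ i′ ≡ j′ →
                   i ≡ j′ → i ≢ i′ → j ≢ j′ → ⊥
  rowColumnClash _ (inj₂ refl) _ refl _ j≢j′ = j≢j′ refl
  rowColumnClash _ _ (inj₂ refl) refl i≢i′ _ = i≢i′ refl
  rowColumnClash (_ , b≤1+a) (inj₁ a<leave) (inj₁ arrive≤b) _ i≢i′ _ =
    <⇒≱ (leave<arrive i≢i′) (≤-trans arrive≤b (≤-trans b≤1+a a<leave))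

  ¬Edge : ∀ {x y} → adj G x y ≡ false → ¬ Edge G x y
  ¬Edge nonadjacent edge with trans (sym edge) nonadjacent
  ... | ()

  gColor≢gColor : ∀ {a b x y} → Edge G x y → gColor a x ≢ gColor b y
  gColor≢gColor {a} {b} {x} {y} edge with gColor a x | gView a x | gColor b y | gView b y
  ... | _ | home _ | _ | home _ = λ { refl → ¬Edge (irrefl G x) edge }
  ... | _ | parked (_ , _ , x∈) | _ | parked (_ , _ , y∈) = λ _ → ¬Edge (freed-independent x∈ y∈) edge
  ... | _ | home _ | _ | parked _ = λ ()
  ... | _ | parked _ | _ | home _ = λ ()

  gColor≢bColor : ∀ {a b x i j} → Near a b → gColor a x ≢ bColor b i j
  gColor≢bColor {a} {b} {x} {i} {j} (a≤1+b , b≤1+a) with gColor a x | gView a x | bColor b i j | bView b i j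
  ... | _ | home ¬P | _ | parking r _ 2≤b b<4 =
    λ { refl → ¬P (s≤s⁻¹ (≤-trans 2≤b b≤1+a) , ≤-trans a≤1+b b<4 , ∈-tabulate⁺ r) }
  ... | _ | home _ | _ | row _ = λ ()
  ... | _ | home _ | _ | column _ = λ ()
  ... | _ | parked _ | _ | row _ = λ ()
  ... | _ | parked _ | _ | column _ = λ ()
  ... | _ | parked _ | _ | parking _ _ _ _ = λ ()

  bColor≢bColor : ∀ {a b i j i′ j′} → Near a b → i ≢ i′ → j ≢ j′ → bColor a i j ≢ bColor b i′ j′
  bColor≢bColor {a} {b} {i} {j} {i′} {j′} near i≢i′ j≢j′
    with bColor a i j | bView a i j | bColor b i′ j′ | bView b i′ j′
  ... | _ | row _ | _ | row _ = λ { refl → i≢i′ refl }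
  ... | _ | column _ | _ | column _ = λ { refl → j≢j′ refl }
  ... | _ | row ρ | _ | column κ = λ { refl → rowColumnClash near ρ κ refl i≢i′ j≢j′ }
  ... | _ | column κ | _ | row ρ = λ { refl → rowColumnClash (near-sym near) ρ κ refl (i≢i′ ∘ sym) (j≢j′ ∘ sym) }
  ... | _ | parking r refl _ _ | _ | parking r′ refl _ _ = i≢i′ ∘ cong suc ∘ e-injective ∘ colG-injective
  ... | _ | row _ | _ | parking _ _ _ _ = λ ()
  ... | _ | column _ | _ | parking _ _ _ _ = λ ()
  ... | _ | parking _ _ _ _ | _ | row _ = λ ()
  ... | _ | parking _ _ _ _ | _ | column _ = λ ()

  bColor≢colLast : ∀ {a i j} → bColor a i j ≢ colLast
  bColor≢colLast {a} {i} {j} with bColor a i j | bView a i j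
  ... | _ | row _ = λ ()
  ... | _ | column _ = λ ()
  ... | _ | parking _ _ _ _ = λ ()

  γ : ℕ → Vertex → Fin k
  γ a (gv x) = encode (gColor a x)
  γ a (bv i j) = encode (bColor a i j)
  γ a (cv m _) = m

  γ-proper-near : ∀ {a b} → Near a b → ∀ u v → Adj' G u v → γ a u ≢ γ b v
  γ-proper-near {a} {b} _ (gv x) (gv y) edge = gColor≢gColor {a} {b} edge ∘ encode-injective
  γ-proper-near near (gv x) (bv i j) _ = gColor≢bColor {x = x} {i} {j} near ∘ encode-injective
  γ-proper-near {a} _ (gv x) (cv m _) (m≢x , m≢last) with gColor a x | gView a x
  ... | _ | home _ = m≢x ∘ sym
  ... | _ | parked _ = m≢last ∘ sym
  γ-proper-near near (bv i j) (gv x) _ = gColor≢bColor {x = x} {i} {j} (near-sym near) ∘ sym ∘ encode-injective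
  γ-proper-near near (bv i j) (bv i′ j′) (i≢i′ , j≢j′) = bColor≢bColor near i≢i′ j≢j′ ∘ encode-injective
  γ-proper-near {a} _ (bv i j) (cv m _) m≡last eq =
    bColor≢colLast {a} {i} {j} (encode-injective (trans eq m≡last))
  γ-proper-near near (cv m r) (gv x) gm = γ-proper-near (near-sym near) (gv x) (cv m r) gm ∘ sym
  γ-proper-near {b = b} _ (cv m _) (bv i j) m≡last eq =
    bColor≢colLast {b} {i} {j} (encode-injective (trans (sym eq) m≡last))

  γ-compatible : ∀ a → Compatible (γ a) (γ (suc a))
  γ-compatible a u v uv =
    γ-proper-near (n≤1+n a , n≤1+n a) u v uv ,
    γ-proper-near (m≤n⇒m≤1+n (n≤1+n a) , ≤-refl) u v uv ,
    γ-proper-near (≤-refl , m≤n⇒m≤1+n (n≤1+n a)) u v uv ,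
    γ-proper-near (n≤1+n (suc a) , n≤1+n (suc a)) u v uv

  parkedVertices firstRow upperRows : List Vertex
  parkedVertices = tabulate (gv ∘ e)
  firstRow = tabulate (bv zero)
  upperRows = tabulate (uncurry (bv ∘ suc) ∘ remQuot t)

  ∈-parkedVertices : ∀ {x} → x ∈ freed → gv x ∈ parkedVertices
  ∈-parkedVertices x∈ with ∈-tabulate⁻ x∈
  ... | r , refl = ∈-tabulate⁺ r

  ∈-upperRows : ∀ r j → bv (suc r) j ∈ upperRows
  ∈-upperRows r j =
    subst (_∈ upperRows) (cong (uncurry (bv ∘ suc)) (remQuot-combine r j)) (∈-tabulate⁺ (combine r j))

  covered₀ : ∀ w → γ 0 w ≢ γ 1 w → w ∈ parkedVertices
  covered₀ (gv x) γ₀≢γ₁ with x ∈ˡ? freed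
  ... | yes x∈ = ∈-parkedVertices x∈
  ... | no _ = contradiction refl γ₀≢γ₁
  covered₀ (bv zero _) γ₀≢γ₁ = contradiction refl γ₀≢γ₁
  covered₀ (bv (suc _) _) γ₀≢γ₁ = contradiction refl γ₀≢γ₁
  covered₀ (cv _ _) γ₀≢γ₁ = contradiction refl γ₀≢γ₁

  covered₁ : ∀ w → γ 1 w ≢ γ 2 w → w ∈ upperRows
  covered₁ (bv (suc r) j) _ = ∈-upperRows r j
  covered₁ (gv _) γ₁≢γ₂ = contradiction refl γ₁≢γ₂
  covered₁ (bv zero _) γ₁≢γ₂ = contradiction refl γ₁≢γ₂
  covered₁ (cv _ _) γ₁≢γ₂ = contradiction refl γ₁≢γ₂

  covered₂ : ∀ w → γ 2 w ≢ γ 3 w → w ∈ firstRow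
  covered₂ (bv zero j) _ = ∈-tabulate⁺ {f = bv zero} j
  covered₂ (gv _) γ₂≢γ₃ = contradiction refl γ₂≢γ₃
  covered₂ (bv (suc _) _) γ₂≢γ₃ = contradiction refl γ₂≢γ₃
  covered₂ (cv _ _) γ₂≢γ₃ = contradiction refl γ₂≢γ₃

  covered₃ : ∀ w → γ 3 w ≢ γ 4 w → w ∈ upperRows
  covered₃ (bv (suc r) j) _ = ∈-upperRows r j
  covered₃ (gv _) γ₃≢γ₄ = contradiction refl γ₃≢γ₄
  covered₃ (bv zero _) γ₃≢γ₄ = contradiction refl γ₃≢γ₄
  covered₃ (cv _ _) γ₃≢γ₄ = contradiction refl γ₃≢γ₄

  covered₄ : ∀ w → γ 4 w ≢ γ 5 w → w ∈ parkedVertices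
  covered₄ (gv x) γ₄≢γ₅ with x ∈ˡ? freed
  ... | yes x∈ = ∈-parkedVertices x∈
  ... | no _ = contradiction refl γ₄≢γ₅
  covered₄ (bv zero _) γ₄≢γ₅ = contradiction refl γ₄≢γ₅
  covered₄ (bv (suc _) _) γ₄≢γ₅ = contradiction refl γ₄≢γ₅
  covered₄ (cv _ _) γ₄≢γ₅ = contradiction refl γ₄≢γ₅

  γ₀≗α : γ 0 ≗ α
  γ₀≗α (gv _) = refl
  γ₀≗α (bv zero _) = refl
  γ₀≗α (bv (suc _) _) = refl
  γ₀≗α (cv _ _) = refl

  γ₅≗β : γ 5 ≗ β
  γ₅≗β (gv _) = refl
  γ₅≗β (bv zero _) = refl
  γ₅≗β (bv (suc _) _) = refl
  γ₅≗β (cv _ _) = refl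

  stageWalk : (a : ℕ) (E : List Vertex) → (∀ w → γ a w ≢ γ (suc a) w → w ∈ E) → Walk (γ a) (γ (suc a)) (length E)
  stageWalk a E covered = recolorWalk (γ-compatible a) E (λ _ → inj₁ refl) covered

  α⇝β : Walk α β (length parkedVertices + (length upperRows + (length firstRow + (length upperRows + length parkedVertices))))
  α⇝β = walk-resp (sym ∘ γ₀≗α) γ₅≗β
    (stageWalk 0 parkedVertices covered₀ ++ʷ stageWalk 1 upperRows covered₁ ++ʷ stageWalk 2 firstRow covered₂ ++ʷ
     stageWalk 3 upperRows covered₃ ++ʷ stageWalk 4 parkedVertices covered₄)

  α⇝β-length : length parkedVertices + (length upperRows + (length firstRow + (length upperRows + length parkedVertices)))
               ≤ ell t
  α⇝β-length = ≤-trans (≤-reflexive lengths) (m+n≤o⇒m≤o _ (≤-reflexive (identity p)))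
    where
      lengths : length parkedVertices + (length upperRows + (length firstRow + (length upperRows + length parkedVertices)))
                ≡ p + (p * t + (t + (p * t + p)))
      lengths = cong₂ _+_ |parked| (cong₂ _+_ |upper| (cong₂ _+_ (length-tabulate {n = t} (bv zero)) (cong₂ _+_ |upper| |parked|)))
        where
          |parked| = length-tabulate (gv ∘ e)
          |upper| = length-tabulate (uncurry (bv ∘ suc) ∘ remQuot {p} t)
      identity : ∀ p → p + (p * suc p + (suc p + (p * suc p + p))) + (p + 3) ≡ 2 * suc p + 2 * (suc p * suc p)
      identity = solve-∀

  path : Σ ℕ λ m → m ≤ ell t × PathOfLength (Adj' G) k α β m
  path with loopErase α⇝β
  ... | m , m≤ , P = m , ≤-trans m≤ α⇝β-length , P

mainTheorem6 : (n t : ℕ) → t > 0 → (G : Graph n) →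
    Σ (Subset n) (λ S → IsIndependent G S × (t ∸ 1) ≤ ∣ S ∣) →
    Σ ℕ (λ m → m ≤ ell t × PathOfLength (Adj' {n} {t} G) (suc (n + t)) α β m)
mainTheorem6 n (suc p) _ G (S , independent , p≤∣S∣) with enumerate S
... | f , f-injective , f∈S = Construction.path n p G e e-injective (λ r r′ → independent (e r) (e r′) (f∈S _) (f∈S _))
  where
    e : Fin p → Fin n
    e r = f (inject≤ r p≤∣S∣)
    e-injective : Injective _≡_ _≡_ e
    e-injective eq = inject≤-injective p≤∣S∣ p≤∣S∣ _ _ (f-injective eq)
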